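{- Consider the online matroid intersection market defined below, and let $i^{\mathrm{inc}}$ be an arriving buyer. For any buyer $i$, let $q^{\mathrm{old}}_i=\min_{e\in P_i}p^{\mathrm{old}}_e$ and $q^{\mathrm{new}}_i=\min_{e\in P_i}p^{\mathrm{new}}_e$. Here $p^{\mathrm{old}}$ and $p^{\mathrm{new}}$ are the canonical prices immediately before and immediately after the arrival of $i^{\mathrm{inc}}$. Then $q^{\mathrm{new}}_i\ge q^{\mathrm{old}}_i$.
   Context: Let $\mathcal{M}$ be a matroid on a finite set $E$ with rank function $\mathrm{rank}$. Let $P_i$, $i\in B$, partition $E$. Arrived buyers have budget $m_i=1$ and unarrived buyers have $m_i=0$. The arrival of $i^{\mathrm{inc}}$ raises $m_{i^{\mathrm{inc}}}$ from $0$ to $1$. For $B'\subseteq B$ write $m(B')=\sum_{i\in B'}m_i$ and $N(B')=\bigcup_{i\in B'}P_i$. For $F\subseteq E$: - $\mathrm{rank}_{\mathcal{M}/F}(X)=\mathrm{rank}(X\cup F)-\mathrm{rank}(F)$; - $\mathrm{Span}_{\mathcal{M}/F}(X)$ is the set of $e\in E\setminus F$ not increasing this rank when added to $X$; - $\mathcal{M}_\ell=\mathcal{M}/E_\ell$ and $\mathrm{InvExp}^{(\ell)}(B')=m(B')/\mathrm{rank}_{\mathcal{M}_\ell}(N(B')\setminus E_\ell)$. Canonical prices come from the MI skeleton algorithm. Set $E_0=\emptyset$ and $B^{\mathrm{rem}}_0=B$. For $\ell=0,1,\dots$ while $B^{\mathrm{rem}}_\ell\ne\emptyset$: 1. Let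 $\rho=\max_{B'\subseteq B^{\mathrm{rem}}_\ell}\mathrm{InvExp}^{(\ell)}(B')$. 2. Let $B_{\ell+1}$ be the unique inclusion-wise largest set attaining $\rho$. 3. Give price $\rho$ to all $e\in S':=\mathrm{Span}_{\mathcal{M}_\ell}(N(B_{\ell+1})\setminus E_\ell)$. 4. Set $E_{\ell+1}=E_\ell\cup S'$ and $B^{\mathrm{rem}}_{\ell+1}=B^{\mathrm{rem}}_\ell\setminus B_{\ell+1}$. These are the prices $p_e=\sum_{S\ni e}\alpha_S$ of an optimal dual of $\max\sum_i m_i\log(\sum_{e\in P_i}y_e)$ s.t. $\sum_{e\in S}y_e\le\mathrm{rank}(S)$ for all $S$, $y\ge0$. Each buyer $i$ with positive budget buys only elements of price $q_i$. -}

module Defs where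

open import Data.Nat as ℕ using (ℕ; zero; suc; _≡ᵇ_)
open import Data.Integer using (+_)
open import Data.Rational using (ℚ; _/_; _*_; _≤_; 0ℚ)
open import Data.Bool using (Bool; true; false; if_then_else_; not; _∧_)
open import Data.Fin using (Fin; _≟_)
open import Data.Fin.Subset using (Subset; _∈_; _∉_; _⊆_; _∪_; _∩_; _─_; ⁅_⁆; ∣_∣; ⊥; ⊤)
open import Data.Vec using (lookup; tabulate)
open import Data.Product using (Σ; _×_; ∃)
open import Data.Sum using (_⊎_)
open import Data.List using (List; []; _∷_)
open import Relation.Nullary using (¬_; does)
open import Relation.Binary.PropositionalEquality using (_≡_; _≢_)

record IsMatroidRank {n : ℕ} (rank : Subset n → ℕ) : Set where
  field
    rank-≤-card  : ∀ X → rank X ℕ.≤ ∣ X ∣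
    rank-mono    : ∀ X Y → X ⊆ Y → rank X ℕ.≤ rank Y
    rank-submod  : ∀ X Y → rank (X ∪ Y) ℕ.+ rank (X ∩ Y) ℕ.≤ rank X ℕ.+ rank Y

module Market {n k : ℕ}
  (rank  : Subset n → ℕ)
  (owner : Fin n → Fin k)      -- partition (P_i)_{i ∈ B}, B = Fin k: e ∈ P_(owner e)
  (arr   : Fin k → Bool)       -- arrived buyers (budget 1) vs unarrived (budget 0)
  where

  P : Fin k → Subset n
  P i = tabulate (λ e → does (owner e ≟ i))

  N : Subset k → Subset n
  N B' = tabulate (λ e → lookup B' (owner e))

  -- m(B') = Σ_{i ∈ B'} m_i with m_i = 1 if arrived and 0 otherwise
  arrived : Subset k
  arrived = tabulate arr

  m : Subset k → ℕ
  m B' = ∣ B' ∩ arrived ∣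

  rankC : Subset n → Subset n → ℕ
  rankC F X = rank (X ∪ F) ℕ.∸ rank F

  SpanC : Subset n → Subset n → Subset n
  SpanC F X = tabulate (λ e → not (lookup F e) ∧ (rankC F (X ∪ ⁅ e ⁆) ≡ᵇ rankC F X))

  toℚ : ℕ → ℚ
  toℚ r = + r / 1

  -- InvExp^(ℓ)(B') = m(B') / rank_{M_ℓ}(N(B') \ E_ℓ), with E_ℓ = F.
  -- Convention: 0/0 is read as 0; a ratio m/0 with m > 0
  -- is +∞ (it is never ≤ a rational ρ, nor equal to one).
  InvExpEq : Subset n → Subset k → ℚ → Set
  InvExpEq F B' ρ =
      (rankC F (N B' ─ F) ≢ 0 × ρ * toℚ (rankC F (N B' ─ F)) ≡ toℚ (m B'))
    ⊎ (rankC F (N B' ─ F) ≡ 0 × m B' ≡ 0 × ρ ≡ 0ℚ)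

  InvExpLe : Subset n → Subset k → ℚ → Set
  InvExpLe F B' ρ =
      (rankC F (N B' ─ F) ≢ 0 × toℚ (m B') ≤ ρ * toℚ (rankC F (N B' ─ F)))
    ⊎ (rankC F (N B' ─ F) ≡ 0 × m B' ≡ 0 × 0ℚ ≤ ρ)

  -- One iteration of the MI skeleton algorithm at level ℓ, with current
  -- E_ℓ = F and B^rem_ℓ = Brem, choosing value ρ and set B_{ℓ+1} = Bl:
  --   ρ = max_{B' ⊆ Brem} InvExp(B'), and Bl is the inclusion-wise largest
  --   subset of Brem attaining ρ.
  record StepOK (F : Subset n) (Brem : Subset k) (ρ : ℚ) (Bl : Subset k) : Set where
    field
      Bl⊆Brem  : Bl ⊆ Brem
      attains  : InvExpEq F Bl ρ
      isMax    : ∀ B' → B' ⊆ Brem → InvExpLe F B' ρ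
      largest  : ∀ B' → B' ⊆ Brem → InvExpEq F B' ρ → B' ⊆ Bl

  record Level : Set where
    constructor level
    field
      ρ  : ℚ
      Bl : Subset k

  -- A complete run of the algorithm from (E_ℓ, B^rem_ℓ) = (F, Brem), assigning
  -- price ρ to every e ∈ S' = Span_{M_ℓ}(N(B_{ℓ+1}) \ E_ℓ) at each level and
  -- stopping when B^rem = ∅; p is the resulting price vector.
  Run : Subset n → Subset k → List Level → (Fin n → ℚ) → Set
  Run F Brem []                 p = ∀ i → i ∉ Brem
  Run F Brem (level ρ Bl ∷ ls)  p =
    StepOK F Brem ρ Bl
    × (∀ e → e ∈ SpanC F (N Bl ─ F) → p e ≡ ρ)
    × Run (F ∪ SpanC F (N Bl ─ F)) (Brem ─ Bl) ls p

  CanonicalPrices : (Fin n → ℚ) → Set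
  CanonicalPrices p = Σ (List Level) (λ ls → Run ⊥ ⊤ ls p)

arrive : {k : ℕ} → (Fin k → Bool) → Fin k → Fin k → Bool
arrive arr iinc j = if does (j ≟ iinc) then true else arr j

IsMinPrice : {n k : ℕ} → (Fin n → Fin k) → (Fin n → ℚ) → Fin k → ℚ → Set
IsMinPrice {n} owner p i q = Σ (Fin n) (λ e → owner e ≡ i × p e ≡ q) × (∀ e → owner e ≡ i → q ≤ p e)

-- Let t = q^old_i. In the old run, the buyers A of the levels priced at least t span every
-- element of old price at least t, and t · rank_{M/(N(A∖X))}(N(A)) ≤ m(X) for every X ⊆ A.
-- In the new run, let G be E_ℓ at the first level priced below t and C the buyers of the earlier
-- levels: G is a flat all of whose elements have new price at least t, and every set X of the
-- remaining buyers with rank_{M/G}(N(X)) > 0 has m′(X) < t · rank_{M/G}(N(X)). Since budgets only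
-- grow and N(A ∩ C) ⊆ G, the two bounds for X = A ∖ C force N(A) into the span of G. The element
-- of P_i realising q^new_i is spanned by N(A), so it lies in the flat G and costs at least t.
-- That G is a flat fails only if the new run starts below t, which is impossible: its first price
-- is at least the first price of the old run, and that one is at least t.

module Submission where

open import Defs
open import Data.Bool using (Bool; true; false; not; T)
open import Data.Bool.Properties using (T-≡; T-∧)
open import Data.Empty using (⊥-elim)
open import Data.Fin using (Fin; _≟_)
open import Data.Fin.Subset
open import Data.Fin.Subset.Properties
open import Data.Integer as ℤ using (+_)
import Data.Integer.Properties as ℤ
open import Data.List using (List; []; _∷_)
open import Data.List.Relation.Unary.All as All using (All; []; _∷_)
open import Data.List.Relation.Unary.Any using (Any; here; there)
open import Data.Nat as ℕ using (ℕ; zero; suc; z≤n; s≤s)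
import Data.Nat.Properties as ℕ
import Data.Nat.Coprimality as Coprime
open import Data.Product using (_×_; _,_; proj₁; proj₂)
open import Data.Rational as ℚ using (ℚ; mkℚ; 0ℚ; _≤_; _<_; _*_; _/_)
import Data.Rational.Properties as ℚ
open import Data.Sum using (_⊎_; inj₁; inj₂; [_,_]; [_,_]′)
open import Data.Unit using (tt) renaming (⊤ to Unit)
open import Data.Vec using (_∷_; []; here; there; lookup; tabulate)
open import Data.Vec.Properties using (lookup∘tabulate; []=⇒lookup; lookup⇒[]=)
open import Function using (_∘_; id; Equivalence)
open import Relation.Nullary using (¬_; yes; no; does)
open import Relation.Binary.PropositionalEquality
  using (_≡_; _≢_; refl; sym; trans; cong; cong₂; subst; subst₂; module ≡-Reasoning)

open Equivalence using (to; from)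

m∸o≤[m∸n]+[n∸o] : ∀ m n o → m ℕ.∸ o ℕ.≤ (m ℕ.∸ n) ℕ.+ (n ℕ.∸ o)
m∸o≤[m∸n]+[n∸o] m       n       zero    = ℕ.≤-trans (ℕ.m≤n+m∸n m n) (ℕ.≤-reflexive (ℕ.+-comm n (m ℕ.∸ n)))
m∸o≤[m∸n]+[n∸o] zero    n       (suc o) = z≤n
m∸o≤[m∸n]+[n∸o] (suc m) zero    (suc o) = ℕ.≤-trans (ℕ.m∸n≤m m o) (ℕ.m≤n⇒m≤1+n (ℕ.m≤m+n m 0))
m∸o≤[m∸n]+[n∸o] (suc m) (suc n) (suc o) = m∸o≤[m∸n]+[n∸o] m n o

m+n≤p+o⇒m∸o≤p∸n : ∀ {m n o p} → n ℕ.≤ p → m ℕ.+ n ℕ.≤ p ℕ.+ o → m ℕ.∸ o ℕ.≤ p ℕ.∸ n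
m+n≤p+o⇒m∸o≤p∸n {m} {n} {o} {p} n≤p m+n≤p+o = ℕ.m≤n+o⇒m∸n≤o m o (ℕ.+-cancelʳ-≤ n m _ (begin
  m ℕ.+ n                   ≤⟨ m+n≤p+o ⟩
  p ℕ.+ o                   ≡⟨ ℕ.+-comm p o ⟩
  o ℕ.+ p                   ≡⟨ cong (o ℕ.+_) (ℕ.m∸n+n≡m n≤p) ⟨
  o ℕ.+ (p ℕ.∸ n ℕ.+ n)     ≡⟨ ℕ.+-assoc o (p ℕ.∸ n) n ⟨
  o ℕ.+ (p ℕ.∸ n) ℕ.+ n     ∎))
  where open ℕ.≤-Reasoning

[m∸o]∸[n∸o]≡m∸n : ∀ m n o → o ℕ.≤ n → (m ℕ.∸ o) ℕ.∸ (n ℕ.∸ o) ≡ m ℕ.∸ n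
[m∸o]∸[n∸o]≡m∸n m       n       zero    _         = refl
[m∸o]∸[n∸o]≡m∸n zero    (suc n) (suc o) _         = ℕ.0∸n≡0 (n ℕ.∸ o)
[m∸o]∸[n∸o]≡m∸n (suc m) (suc n) (suc o) (s≤s o≤n) = [m∸o]∸[n∸o]≡m∸n m n o o≤n

m∸o≡[m∸n]+[n∸o] : ∀ {m n o} → o ℕ.≤ n → n ℕ.≤ m → m ℕ.∸ o ≡ (m ℕ.∸ n) ℕ.+ (n ℕ.∸ o)
m∸o≡[m∸n]+[n∸o] {m} {n} {o} o≤n n≤m = begin
  m ℕ.∸ o                       ≡⟨ cong (ℕ._∸ o) (ℕ.m∸n+n≡m n≤m) ⟨
  (m ℕ.∸ n) ℕ.+ n ℕ.∸ o         ≡⟨ ℕ.+-∸-assoc (m ℕ.∸ n) o≤n ⟩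
  (m ℕ.∸ n) ℕ.+ (n ℕ.∸ o)       ∎
  where open ≡-Reasoning

-- Coincides definitionally with Market.toℚ.
toℚ : ℕ → ℚ
toℚ r = + r / 1

toℚ≡mkℚ : ∀ r → toℚ r ≡ mkℚ (+ r) 0 (Coprime.sym (Coprime.1-coprimeTo r))
toℚ≡mkℚ r = ℚ.normalize-coprime _

toℚ-+ : ∀ a b → toℚ (a ℕ.+ b) ≡ toℚ a ℚ.+ toℚ b
toℚ-+ a b = begin
  + (a ℕ.+ b) / 1                          ≡⟨ ℚ./-cong (cong₂ ℤ._+_ (ℤ.*-identityʳ (+ a)) (ℤ.*-identityʳ (+ b))) refl ⟨
  mkℚ (+ a) 0 cᵃ ℚ.+ mkℚ (+ b) 0 cᵇ       ≡⟨ cong₂ ℚ._+_ (toℚ≡mkℚ a) (toℚ≡mkℚ b) ⟨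
  toℚ a ℚ.+ toℚ b                          ∎
  where
  open ≡-Reasoning
  cᵃ : Coprime.Coprime a 1
  cᵃ = Coprime.sym (Coprime.1-coprimeTo a)
  cᵇ : Coprime.Coprime b 1
  cᵇ = Coprime.sym (Coprime.1-coprimeTo b)

toℚ-mono-≤ : ∀ {a b} → a ℕ.≤ b → toℚ a ≤ toℚ b
toℚ-mono-≤ {a} {b} a≤b rewrite toℚ≡mkℚ a | toℚ≡mkℚ b =
  ℚ.*≤* (subst₂ ℤ._≤_ (sym (ℤ.*-identityʳ (+ a))) (sym (ℤ.*-identityʳ (+ b))) (ℤ.+≤+ a≤b))

toℚ-nonNeg : ∀ a → 0ℚ ≤ toℚ a
toℚ-nonNeg a = toℚ-mono-≤ {0} {a} z≤n

toℚ-positive : ∀ {a} → a ≢ 0 → ℚ.Positive (toℚ a)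
toℚ-positive {zero}  a≢0 = ⊥-elim (a≢0 refl)
toℚ-positive {suc a} _   = subst ℚ.Positive (sym (toℚ≡mkℚ (suc a))) _

+-cancelʳ-≤ : ∀ {p q} r → p ℚ.+ r ≤ q ℚ.+ r → p ≤ q
+-cancelʳ-≤ {p} {q} r p+r≤q+r = subst₂ _≤_ (cancel p) (cancel q) (ℚ.+-monoˡ-≤ (ℚ.- r) p+r≤q+r)
  where
  cancel : ∀ x → x ℚ.+ r ℚ.+ ℚ.- r ≡ x
  cancel x = trans (ℚ.+-assoc x r (ℚ.- r)) (trans (cong (x ℚ.+_) (ℚ.+-inverseʳ r)) (ℚ.+-identityʳ x))

*-∸-≤-split : ∀ ρ m₁ m₂ {a b} → b ℕ.≤ a → ρ * toℚ a ≡ toℚ (m₁ ℕ.+ m₂) → toℚ m₂ ≤ ρ * toℚ b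
            → ρ * toℚ (a ℕ.∸ b) ≤ toℚ m₁
*-∸-≤-split ρ m₁ m₂ {a} {b} b≤a ρa≡m₁+m₂ m₂≤ρb = +-cancelʳ-≤ (ρ * toℚ b) (begin
  ρ * toℚ (a ℕ.∸ b) ℚ.+ ρ * toℚ b     ≡⟨ ℚ.*-distribˡ-+ ρ (toℚ (a ℕ.∸ b)) (toℚ b) ⟨
  ρ * (toℚ (a ℕ.∸ b) ℚ.+ toℚ b)       ≡⟨ cong (ρ *_) (toℚ-+ (a ℕ.∸ b) b) ⟨
  ρ * toℚ (a ℕ.∸ b ℕ.+ b)             ≡⟨ cong (λ c → ρ * toℚ c) (ℕ.m∸n+n≡m b≤a) ⟩
  ρ * toℚ a                           ≡⟨ ρa≡m₁+m₂ ⟩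
  toℚ (m₁ ℕ.+ m₂)                     ≡⟨ toℚ-+ m₁ m₂ ⟩
  toℚ m₁ ℚ.+ toℚ m₂                   ≤⟨ ℚ.+-monoʳ-≤ (toℚ m₁) m₂≤ρb ⟩
  toℚ m₁ ℚ.+ ρ * toℚ b                ∎)
  where open ℚ.≤-Reasoning

*-monoʳ-≤-toℚ : ∀ a {p q} → p ≤ q → p * toℚ a ≤ q * toℚ a
*-monoʳ-≤-toℚ a = ℚ.*-monoʳ-≤-nonNeg (toℚ a) {{ℚ.nonNegative (toℚ-nonNeg a)}}

private variable n : ℕ

∪-lub : ∀ {p q r : Subset n} → p ⊆ r → q ⊆ r → p ∪ q ⊆ r
∪-lub {p = p} {q = q} p⊆r q⊆r x∈p∪q = [ p⊆r , q⊆r ] (x∈p∪q⁻ p q x∈p∪q)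

∪-mono : ∀ {p p′ q q′ : Subset n} → p ⊆ p′ → q ⊆ q′ → p ∪ q ⊆ p′ ∪ q′
∪-mono {p′ = p′} {q′ = q′} p⊆p′ q⊆q′ = ∪-lub (λ x∈p → p⊆p∪q q′ (p⊆p′ x∈p)) (λ x∈q → q⊆p∪q p′ q′ (q⊆q′ x∈q))

x∈p─q⇒x∉q : ∀ {x} (p q : Subset n) → x ∈ p ─ q → x ∉ q
x∈p─q⇒x∉q (inside ∷ p) (outside ∷ q) here       ()
x∈p─q⇒x∉q (_ ∷ p)      (_ ∷ q)       (there x∈) (there x∈q) = x∈p─q⇒x∉q p q x∈ x∈q

p⊆[p─q]∪q : ∀ (p q : Subset n) → p ⊆ (p ─ q) ∪ q
p⊆[p─q]∪q p q {x} x∈p with x ∈? q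
... | yes x∈q = q⊆p∪q (p ─ q) q x∈q
... | no  x∉q = p⊆p∪q q (x∈p∧x∉q⇒x∈p─q x∈p x∉q)

[p─q]∪q≡p∪q : ∀ (p q : Subset n) → (p ─ q) ∪ q ≡ p ∪ q
[p─q]∪q≡p∪q p q = ⊆-antisym (∪-mono (p─q⊆p p q) id)
                            (∪-lub (p⊆[p─q]∪q p q) (q⊆p∪q (p ─ q) q))

x∈p⇒T[lookup] : ∀ {x} {p : Subset n} → x ∈ p → T (lookup p x)
x∈p⇒T[lookup] x∈p = from T-≡ ([]=⇒lookup x∈p)

T[lookup]⇒x∈p : ∀ {x} {p : Subset n} → T (lookup p x) → x ∈ p
T[lookup]⇒x∈p {x = x} {p} t = lookup⇒[]= x p (to T-≡ t)

x∈tabulate⁻ : ∀ {x} (f : Fin n → Bool) → x ∈ tabulate f → T (f x)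
x∈tabulate⁻ {x = x} f x∈ = subst T (lookup∘tabulate f x) (x∈p⇒T[lookup] x∈)

x∈tabulate⁺ : ∀ {x} (f : Fin n → Bool) → T (f x) → x ∈ tabulate f
x∈tabulate⁺ {x = x} f t = T[lookup]⇒x∈p (subst T (sym (lookup∘tabulate f x)) t)

∣p∩r∣≡∣p∩q∩r∣+∣p─q∩r∣ : ∀ (p q r : Subset n) → ∣ p ∩ r ∣ ≡ ∣ (p ∩ q) ∩ r ∣ ℕ.+ ∣ (p ─ q) ∩ r ∣
∣p∩r∣≡∣p∩q∩r∣+∣p─q∩r∣ [] [] [] = refl
∣p∩r∣≡∣p∩q∩r∣+∣p─q∩r∣ (outside ∷ p) (outside ∷ q) (_ ∷ r) = ∣p∩r∣≡∣p∩q∩r∣+∣p─q∩r∣ p q r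
∣p∩r∣≡∣p∩q∩r∣+∣p─q∩r∣ (outside ∷ p) (inside ∷ q) (_ ∷ r) = ∣p∩r∣≡∣p∩q∩r∣+∣p─q∩r∣ p q r
∣p∩r∣≡∣p∩q∩r∣+∣p─q∩r∣ (inside ∷ p) (outside ∷ q) (outside ∷ r) = ∣p∩r∣≡∣p∩q∩r∣+∣p─q∩r∣ p q r
∣p∩r∣≡∣p∩q∩r∣+∣p─q∩r∣ (inside ∷ p) (inside ∷ q) (outside ∷ r) = ∣p∩r∣≡∣p∩q∩r∣+∣p─q∩r∣ p q r
∣p∩r∣≡∣p∩q∩r∣+∣p─q∩r∣ (inside ∷ p) (outside ∷ q) (inside ∷ r) =
  trans (cong suc (∣p∩r∣≡∣p∩q∩r∣+∣p─q∩r∣ p q r)) (sym (ℕ.+-suc _ _))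
∣p∩r∣≡∣p∩q∩r∣+∣p─q∩r∣ (inside ∷ p) (inside ∷ q) (inside ∷ r) = cong suc (∣p∩r∣≡∣p∩q∩r∣+∣p─q∩r∣ p q r)

T[not-lookup]⇒x∉p : ∀ {x} {p : Subset n} → T (not (lookup p x)) → x ∉ p
T[not-lookup]⇒x∉p t x∈p = subst (T ∘ not) ([]=⇒lookup x∈p) t

x∉p⇒T[not-lookup] : ∀ {x} {p : Subset n} → x ∉ p → T (not (lookup p x))
x∉p⇒T[not-lookup] {x = x} {p} x∉p with lookup p x in eq
... | true  = ⊥-elim (x∉p (lookup⇒[]= x p eq))
... | false = tt

module Rank {rank : Subset n → ℕ} (isMatroid : IsMatroidRank rank) where

  open IsMatroidRank isMatroid

  Spans : Subset n → Fin n → Set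
  Spans X e = rank (X ∪ ⁅ e ⁆) ≡ rank X

  Flat : Subset n → Set
  Flat X = ∀ e → e ∉ X → ¬ Spans X e

  rank-⊆ : ∀ {X Y} → X ⊆ Y → rank X ℕ.≤ rank Y
  rank-⊆ = rank-mono _ _

  rank-squeeze : ∀ {X Y Z} → X ⊆ Y → Y ⊆ Z → rank Z ≡ rank X → rank Y ≡ rank X
  rank-squeeze {Y = Y} X⊆Y Y⊆Z rZ≡rX = ℕ.≤-antisym (subst (rank Y ℕ.≤_) rZ≡rX (rank-⊆ Y⊆Z)) (rank-⊆ X⊆Y)

  rank-submod-⊆ : ∀ X Y {W} → W ⊆ X ∩ Y → rank (X ∪ Y) ℕ.+ rank W ℕ.≤ rank X ℕ.+ rank Y
  rank-submod-⊆ X Y W⊆X∩Y = ℕ.≤-trans (ℕ.+-monoʳ-≤ (rank (X ∪ Y)) (rank-⊆ W⊆X∩Y)) (rank-submod X Y)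

  rank-∸-submod : ∀ X Y {W} → W ⊆ X ∩ Y → rank (X ∪ Y) ℕ.∸ rank Y ℕ.≤ rank X ℕ.∸ rank W
  rank-∸-submod X Y W⊆X∩Y =
    m+n≤p+o⇒m∸o≤p∸n (rank-⊆ (proj₁ ∘ x∈p∩q⁻ X Y ∘ W⊆X∩Y)) (rank-submod-⊆ X Y W⊆X∩Y)

  ∈⇒Spans : ∀ {X e} → e ∈ X → Spans X e
  ∈⇒Spans {X} {e} e∈X = cong rank (⊆-antisym (∪-lub id ⁅e⁆⊆X) (p⊆p∪q ⁅ e ⁆))
    where
    ⁅e⁆⊆X : ⁅ e ⁆ ⊆ X
    ⁅e⁆⊆X x∈⁅e⁆ = subst (_∈ X) (sym (x∈⁅y⁆⇒x≡y e x∈⁅e⁆)) e∈X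

  Spans-mono : ∀ {X Y e} → X ⊆ Y → Spans X e → Spans Y e
  Spans-mono {X} {Y} {e} X⊆Y X-spans = ℕ.≤-antisym rY∪e≤rY (rank-⊆ (p⊆p∪q ⁅ e ⁆))
    where
    submod : rank (Y ∪ (X ∪ ⁅ e ⁆)) ℕ.+ rank X ℕ.≤ rank Y ℕ.+ rank X
    submod = subst (λ r → rank (Y ∪ (X ∪ ⁅ e ⁆)) ℕ.+ rank X ℕ.≤ rank Y ℕ.+ r) X-spans
               (rank-submod-⊆ Y (X ∪ ⁅ e ⁆) (λ x∈X → x∈p∩q⁺ (X⊆Y x∈X , p⊆p∪q ⁅ e ⁆ x∈X)))
    rY∪e≤rY : rank (Y ∪ ⁅ e ⁆) ℕ.≤ rank Y
    rY∪e≤rY = ℕ.≤-trans (rank-⊆ (∪-mono id (q⊆p∪q X ⁅ e ⁆))) (ℕ.+-cancelʳ-≤ (rank X) _ _ submod)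

  Spans-restrict : ∀ {X Y e} → X ⊆ Y → rank Y ≡ rank X → Spans Y e → Spans X e
  Spans-restrict {X} {Y} {e} X⊆Y rY≡rX Y-spans =
    rank-squeeze (p⊆p∪q ⁅ e ⁆) (∪-mono X⊆Y id) (trans Y-spans rY≡rX)

  rank-∪-spanned : ∀ X S → (∀ {e} → e ∈ S → Spans X e) → rank (X ∪ S) ≡ rank X
  rank-∪-spanned X S = go ∣ S ∣ S ℕ.≤-refl
    where
    go : ∀ c S → ∣ S ∣ ℕ.≤ c → (∀ {e} → e ∈ S → Spans X e) → rank (X ∪ S) ≡ rank X
    go c S _ spanned with nonempty? S
    ... | no ∄e = cong rank (⊆-antisym (∪-lub id (λ e∈S → ⊥-elim (∄e (_ , e∈S)))) (p⊆p∪q S))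
    go zero    S ∣S∣≤0 spanned | yes (e , e∈S) =
      ⊥-elim (ℕ.n≮0 (ℕ.<-≤-trans (x∈p⇒∣p-x∣<∣p∣ e∈S) ∣S∣≤0))
    go (suc c) S ∣S∣≤c+1 spanned | yes (e , e∈S) =
      rank-squeeze (p⊆p∪q S) X∪S⊆ (trans (Spans-mono (p⊆p∪q (S - e)) (spanned e∈S)) ih)
      where
      ih : rank (X ∪ (S - e)) ≡ rank X
      ih = go c (S - e) (ℕ.≤-pred (ℕ.<-≤-trans (x∈p⇒∣p-x∣<∣p∣ e∈S) ∣S∣≤c+1)) (spanned ∘ p─q⊆p S ⁅ e ⁆)
      X∪S⊆ : X ∪ S ⊆ (X ∪ (S - e)) ∪ ⁅ e ⁆
      X∪S⊆ = ∪-lub (p⊆p∪q ⁅ e ⁆ ∘ p⊆p∪q (S - e)) (∪-mono (q⊆p∪q X (S - e)) id ∘ p⊆[p─q]∪q S ⁅ e ⁆)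

module Skeleton {k : ℕ} {rank : Subset n → ℕ} (isMatroid : IsMatroidRank rank) (owner : Fin n → Fin k) where

  open Rank isMatroid
  -- N, rankC and SpanC do not depend on the budgets.
  open Market rank owner (λ _ → false) using (N; rankC; SpanC)

  x∈N⁺ : ∀ {B e} → owner e ∈ B → e ∈ N B
  x∈N⁺ = x∈tabulate⁺ _ ∘ x∈p⇒T[lookup]

  x∈N⁻ : ∀ {B e} → e ∈ N B → owner e ∈ B
  x∈N⁻ = T[lookup]⇒x∈p ∘ x∈tabulate⁻ _

  N-mono : ∀ {B C} → B ⊆ C → N B ⊆ N C
  N-mono B⊆C = x∈N⁺ ∘ B⊆C ∘ x∈N⁻

  N-∪ : ∀ B C → N (B ∪ C) ≡ N B ∪ N C
  N-∪ B C = ⊆-antisym (λ e∈ → [ p⊆p∪q (N C) ∘ x∈N⁺ , q⊆p∪q (N B) (N C) ∘ x∈N⁺ ] (x∈p∪q⁻ B C (x∈N⁻ e∈)))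
                      (∪-lub (N-mono {B} {B ∪ C} (p⊆p∪q C)) (N-mono {C} {B ∪ C} (q⊆p∪q B C)))

  N⊥⊆ : ∀ {X} → N ⊥ ⊆ X
  N⊥⊆ = ⊥-elim ∘ ∉⊥ ∘ x∈N⁻

  ∈SpanC⁻ : ∀ {F X e} → e ∈ SpanC F X → e ∉ F × rankC F (X ∪ ⁅ e ⁆) ≡ rankC F X
  ∈SpanC⁻ e∈ with to T-∧ (x∈tabulate⁻ _ e∈)
  ... | e∉F , same-rank = T[not-lookup]⇒x∉p e∉F , ℕ.≡ᵇ⇒≡ _ _ same-rank

  ∈SpanC⁺ : ∀ {F X e} → e ∉ F → rankC F (X ∪ ⁅ e ⁆) ≡ rankC F X → e ∈ SpanC F X
  ∈SpanC⁺ e∉F same-rank = x∈tabulate⁺ _ (from T-∧ (x∉p⇒T[not-lookup] e∉F , ℕ.≡⇒≡ᵇ _ _ same-rank))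

  rankC-─ : ∀ F Y → rankC F (Y ─ F) ≡ rank (Y ∪ F) ℕ.∸ rank F
  rankC-─ F Y = cong (λ Z → rank Z ℕ.∸ rank F) ([p─q]∪q≡p∪q Y F)

  rankC-─∪ : ∀ F Y Z → rankC F ((Y ─ F) ∪ Z) ≡ rank ((Y ∪ F) ∪ Z) ℕ.∸ rank F
  rankC-─∪ F Y Z = cong (λ W → rank W ℕ.∸ rank F) (begin
    ((Y ─ F) ∪ Z) ∪ F     ≡⟨ ∪-assoc (Y ─ F) Z F ⟩
    (Y ─ F) ∪ (Z ∪ F)     ≡⟨ cong ((Y ─ F) ∪_) (∪-comm Z F) ⟩
    (Y ─ F) ∪ (F ∪ Z)     ≡⟨ ∪-assoc (Y ─ F) F Z ⟨
    ((Y ─ F) ∪ F) ∪ Z     ≡⟨ cong (_∪ Z) ([p─q]∪q≡p∪q Y F) ⟩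
    (Y ∪ F) ∪ Z           ∎)
    where open ≡-Reasoning

  -- E_{ℓ+1} from E_ℓ = F and N(B_{ℓ+1}) = Y.
  next : Subset n → Subset n → Subset n
  next F Y = F ∪ SpanC F (Y ─ F)

  ∈next⇒Spans : ∀ {F Y e} → e ∈ next F Y → Spans (Y ∪ F) e
  ∈next⇒Spans {F} {Y} {e} e∈ with x∈p∪q⁻ F _ e∈
  ... | inj₁ e∈F = ∈⇒Spans (q⊆p∪q Y F e∈F)
  ... | inj₂ e∈S = ℕ.∸-cancelʳ-≡ (rank-⊆ (p⊆p∪q ⁅ e ⁆ ∘ q⊆p∪q Y F)) (rank-⊆ (q⊆p∪q Y F))
      (trans (sym (rankC-─∪ F Y ⁅ e ⁆)) (trans (proj₂ (∈SpanC⁻ e∈S)) (rankC-─ F Y)))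

  Spans⇒∈next : ∀ {F Y e} → Spans (Y ∪ F) e → e ∈ next F Y
  Spans⇒∈next {F} {Y} {e} spans with e ∈? F
  ... | yes e∈F = p⊆p∪q _ e∈F
  ... | no  e∉F = q⊆p∪q F _ (∈SpanC⁺ e∉F
      (trans (rankC-─∪ F Y ⁅ e ⁆) (trans (cong (ℕ._∸ rank F) spans) (sym (rankC-─ F Y)))))

  F⊆next : ∀ {F Y} → F ⊆ next F Y
  F⊆next {F} = p⊆p∪q _

  Y⊆next : ∀ {F Y} → Y ⊆ next F Y
  Y⊆next {F} = Spans⇒∈next ∘ ∈⇒Spans ∘ p⊆p∪q F

  rank-∪-next : ∀ F Y Z → rank (Z ∪ next F Y) ≡ rank (Z ∪ (Y ∪ F))
  rank-∪-next F Y Z =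
    rank-squeeze (∪-mono id (∪-lub Y⊆next F⊆next)) (∪-lub (p⊆p∪q (next F Y) ∘ p⊆p∪q (Y ∪ F)) (q⊆p∪q _ (next F Y)))
      (rank-∪-spanned (Z ∪ (Y ∪ F)) (next F Y) (Spans-mono (q⊆p∪q Z (Y ∪ F)) ∘ ∈next⇒Spans))

  rank-next : ∀ F Y → rank (next F Y) ≡ rank (Y ∪ F)
  rank-next F Y = begin
    rank (next F Y)             ≡⟨ cong rank (∪-identityˡ (next F Y)) ⟨
    rank (⊥ ∪ next F Y)         ≡⟨ rank-∪-next F Y ⊥ ⟩
    rank (⊥ ∪ (Y ∪ F))          ≡⟨ cong rank (∪-identityˡ (Y ∪ F)) ⟩
    rank (Y ∪ F)                ∎
    where open ≡-Reasoning

  next-flat : ∀ F Y → Flat (next F Y)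
  next-flat F Y e e∉next spans =
    e∉next (Spans⇒∈next (Spans-restrict (∪-lub Y⊆next F⊆next) (rank-next F Y) spans))

  ∈next⇒∈SpanC : ∀ {F Y e} → e ∈ next F Y → e ∉ F → e ∈ SpanC F (Y ─ F)
  ∈next⇒∈SpanC {F} e∈ e∉F = [ ⊥-elim ∘ e∉F , id ] (x∈p∪q⁻ F _ e∈)

  rankN : Subset n → Subset k → ℕ
  rankN F B = rank (N B ∪ F) ℕ.∸ rank F

  rankC-N : ∀ F B → rankC F (N B ─ F) ≡ rankN F B
  rankC-N F B = rankC-─ F (N B)

  rankN-⊆ : ∀ {F B} → N B ⊆ F → rankN F B ≡ 0
  rankN-⊆ {F} {B} NB⊆F =
    trans (cong (λ Z → rank Z ℕ.∸ rank F) (⊆-antisym (∪-lub NB⊆F id) (q⊆p∪q (N B) F))) (ℕ.n∸n≡0 (rank F))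

  rankN-mono : ∀ F {B C} → B ⊆ C → rankN F B ℕ.≤ rankN F C
  rankN-mono F {B} {C} B⊆C = ℕ.∸-monoˡ-≤ (rank F) (rank-⊆ (∪-mono (N-mono {B} {C} B⊆C) id))

  N-∪-⊆-next : ∀ F B C → N (B ∪ C) ∪ F ⊆ N C ∪ next F (N B)
  N-∪-⊆-next F B C = ∪-lub (∪-lub (q⊆p∪q (N C) _ ∘ Y⊆next) (p⊆p∪q _) ∘ subst (_ ∈_) (N-∪ B C))
                           (q⊆p∪q (N C) _ ∘ F⊆next)

  rank-N-next : ∀ F B C → rank (N C ∪ next F (N B)) ≡ rank (N (B ∪ C) ∪ F)
  rank-N-next F B C = trans (rank-∪-next F (N B) (N C)) (cong rank (begin
    N C ∪ (N B ∪ F)       ≡⟨ ∪-assoc (N C) (N B) F ⟨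
    (N C ∪ N B) ∪ F       ≡⟨ cong (_∪ F) (∪-comm (N C) (N B)) ⟩
    (N B ∪ N C) ∪ F       ≡⟨ cong (_∪ F) (N-∪ B C) ⟨
    N (B ∪ C) ∪ F         ∎))
    where open ≡-Reasoning

  rankN-next : ∀ F B C → rankN F (B ∪ C) ≡ rankN (next F (N B)) C ℕ.+ rankN F B
  rankN-next F B C = begin
    rank (N (B ∪ C) ∪ F) ℕ.∸ rank F        ≡⟨ cong (ℕ._∸ rank F) (rank-N-next F B C) ⟨
    rank (N C ∪ F′) ℕ.∸ rank F             ≡⟨ m∸o≡[m∸n]+[n∸o] (rank-⊆ F⊆next) (rank-⊆ (q⊆p∪q (N C) F′)) ⟩
    rankN F′ C ℕ.+ (rank F′ ℕ.∸ rank F)    ≡⟨ cong (λ r → rankN F′ C ℕ.+ (r ℕ.∸ rank F)) (rank-next F (N B)) ⟩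
    rankN F′ C ℕ.+ rankN F B               ∎
    where
    open ≡-Reasoning
    F′ : Subset n
    F′ = next F (N B)

  rank-drop-split : ∀ F B A′ X → (∀ {o} → o ∈ A′ → o ∉ B)
    → rank (N (B ∪ A′) ∪ F) ℕ.∸ rank (N ((B ∪ A′) ─ X) ∪ F)
      ℕ.≤ (rank (N A′ ∪ next F (N B)) ℕ.∸ rank (N (A′ ─ (X ─ B)) ∪ next F (N B)))
          ℕ.+ (rank (N B ∪ F) ℕ.∸ rank (N (B ─ X) ∪ F))
  rank-drop-split F B A′ X disjoint = begin
    a ℕ.∸ s                       ≡⟨ cong (ℕ._∸ s) (rank-N-next F B A′) ⟨
    a′ ℕ.∸ s                      ≤⟨ m∸o≤[m∸n]+[n∸o] a′ b s ⟩
    (a′ ℕ.∸ b) ℕ.+ (b ℕ.∸ s)      ≤⟨ ℕ.+-monoʳ-≤ (a′ ℕ.∸ b) b∸s≤c∸d ⟩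
    (a′ ℕ.∸ b) ℕ.+ (c ℕ.∸ d)      ∎
    where
    open ℕ.≤-Reasoning
    A : Subset k
    A = B ∪ A′
    F′ S W : Subset n
    F′ = next F (N B)
    S = N (A ─ X) ∪ F
    W = N (B ─ X) ∪ F
    a a′ b c d s : ℕ
    a = rank (N A ∪ F)
    a′ = rank (N A′ ∪ F′)
    b = rank (N (A′ ─ (X ─ B)) ∪ F′)
    c = rank (N B ∪ F)
    d = rank W
    s = rank S
    A′─[X─B]⊆A─X : A′ ─ (X ─ B) ⊆ A ─ X
    A′─[X─B]⊆A─X o∈ = x∈p∧x∉q⇒x∈p─q (q⊆p∪q B A′ o∈A′)
                                      (λ o∈X → x∈p─q⇒x∉q A′ (X ─ B) o∈ (x∈p∧x∉q⇒x∈p─q o∈X (disjoint o∈A′)))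
      where o∈A′ = p─q⊆p A′ (X ─ B) o∈
    B─X⊆A─X : B ─ X ⊆ A ─ X
    B─X⊆A─X o∈ = x∈p∧x∉q⇒x∈p─q (p⊆p∪q A′ (p─q⊆p B X o∈)) (x∈p─q⇒x∉q B X o∈)
    W⊆F′∩S : W ⊆ F′ ∩ S
    W⊆F′∩S w∈ = x∈p∩q⁺ (∪-lub (Y⊆next ∘ N-mono {B ─ X} {B} (p─q⊆p B X)) F⊆next w∈
                       , ∪-mono (N-mono {B ─ X} {A ─ X} B─X⊆A─X) id w∈)
    b∸s≤c∸d : b ℕ.∸ s ℕ.≤ c ℕ.∸ d
    b∸s≤c∸d = begin
      b ℕ.∸ s                     ≤⟨ ℕ.∸-monoˡ-≤ s (rank-⊆ (∪-lub (q⊆p∪q F′ S ∘ p⊆p∪q F ∘ N-mono A′─[X─B]⊆A─X)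
                                                                 (p⊆p∪q S))) ⟩
      rank (F′ ∪ S) ℕ.∸ s         ≤⟨ rank-∸-submod F′ S W⊆F′∩S ⟩
      rank F′ ℕ.∸ d               ≡⟨ cong (ℕ._∸ d) (rank-next F (N B)) ⟩
      c ℕ.∸ d                     ∎

  OwnsComplement : Subset k → Subset n → Set
  OwnsComplement Brem F = ∀ e → e ∉ F → owner e ∈ Brem

  ownsComplement-next : ∀ {Brem F B} → OwnsComplement Brem F → OwnsComplement (Brem ─ B) (next F (N B))
  ownsComplement-next owns e e∉F′ = x∈p∧x∉q⇒x∈p─q (owns e (e∉F′ ∘ F⊆next)) (e∉F′ ∘ Y⊆next ∘ x∈N⁺)

module Runs {k : ℕ} {rank : Subset n → ℕ} (isMatroid : IsMatroidRank rank) (owner : Fin n → Fin k)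
            (arr : Fin k → Bool) where

  open Rank isMatroid
  open Skeleton isMatroid owner
  open Market rank owner arr public hiding (toℚ)

  m-split : ∀ X B → m X ≡ m (X ∩ B) ℕ.+ m (X ─ B)
  m-split X B = ∣p∩r∣≡∣p∩q∩r∣+∣p─q∩r∣ X B arrived

  m-∪ : ∀ B C → (∀ {x} → x ∈ C → x ∉ B) → m (B ∪ C) ≡ m B ℕ.+ m C
  m-∪ B C disjoint = trans (m-split (B ∪ C) B) (cong₂ ℕ._+_ (cong m [B∪C]∩B≡B) (cong m [B∪C]─B≡C))
    where
    [B∪C]∩B≡B : (B ∪ C) ∩ B ≡ B
    [B∪C]∩B≡B = trans (∩-comm (B ∪ C) B) (∩-abs-∪ B C)
    [B∪C]─B≡C : (B ∪ C) ─ B ≡ C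
    [B∪C]─B≡C = ⊆-antisym
      (λ x∈ → [ ⊥-elim ∘ x∈p─q⇒x∉q (B ∪ C) B x∈ , id ] (x∈p∪q⁻ B C (p─q⊆p (B ∪ C) B x∈)))
      (λ x∈C → x∈p∧x∉q⇒x∈p─q (q⊆p∪q B C x∈C) (disjoint x∈C))

  InvExpEq⇒ : ∀ F B {ρ} → InvExpEq F B ρ → ρ * toℚ (rankN F B) ≡ toℚ (m B)
  InvExpEq⇒ F B {ρ} (inj₁ (_ , ρr≡m)) = subst (λ r → ρ * toℚ r ≡ toℚ (m B)) (rankC-N F B) ρr≡m
  InvExpEq⇒ F B {ρ} (inj₂ (r≡0 , m≡0 , _)) = begin
    ρ * toℚ (rankN F B)   ≡⟨ cong (λ r → ρ * toℚ r) (trans (sym (rankC-N F B)) r≡0) ⟩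
    ρ * 0ℚ                ≡⟨ ℚ.*-zeroʳ ρ ⟩
    0ℚ                    ≡⟨ cong toℚ m≡0 ⟨
    toℚ (m B)             ∎
    where open ≡-Reasoning

  InvExpEq⁺ : ∀ F B {ρ} → rankN F B ≢ 0 → ρ * toℚ (rankN F B) ≡ toℚ (m B) → InvExpEq F B ρ
  InvExpEq⁺ F B {ρ} r≢0 ρr≡m =
    inj₁ (r≢0 ∘ trans (sym (rankC-N F B)) , subst (λ r → ρ * toℚ r ≡ toℚ (m B)) (sym (rankC-N F B)) ρr≡m)

  InvExpLe⇒ : ∀ F B {ρ} → InvExpLe F B ρ → toℚ (m B) ≤ ρ * toℚ (rankN F B)
  InvExpLe⇒ F B {ρ} (inj₁ (_ , m≤ρr)) = subst (λ r → toℚ (m B) ≤ ρ * toℚ r) (rankC-N F B) m≤ρr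
  InvExpLe⇒ F B {ρ} (inj₂ (r≡0 , m≡0 , _)) = begin
    toℚ (m B)             ≡⟨ cong toℚ m≡0 ⟩
    0ℚ                    ≡⟨ ℚ.*-zeroʳ ρ ⟨
    ρ * 0ℚ                ≡⟨ cong (λ r → ρ * toℚ r) (trans (sym (rankC-N F B)) r≡0) ⟨
    ρ * toℚ (rankN F B)   ∎
    where open ℚ.≤-Reasoning

  InvExpEq-rank₀ : ∀ F B {ρ} → InvExpEq F B ρ → rankN F B ≡ 0 → ρ ≡ 0ℚ
  InvExpEq-rank₀ F B (inj₁ (r≢0 , _))     r≡0 = ⊥-elim (r≢0 (trans (rankC-N F B) r≡0))
  InvExpEq-rank₀ F B (inj₂ (_ , _ , ρ≡0)) _   = ρ≡0

  InvExpLe-rank₀ : ∀ F B {ρ} → InvExpLe F B ρ → rankN F B ≡ 0 → 0ℚ ≤ ρ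
  InvExpLe-rank₀ F B (inj₁ (r≢0 , _))     r≡0 = ⊥-elim (r≢0 (trans (rankC-N F B) r≡0))
  InvExpLe-rank₀ F B (inj₂ (_ , _ , 0≤ρ)) _   = 0≤ρ

  ρ-nonneg : ∀ {F Brem ρ B} → StepOK F Brem ρ B → 0ℚ ≤ ρ
  ρ-nonneg {F} {Brem} step = InvExpLe-rank₀ F ⊥ (StepOK.isMax step ⊥ (⊆-min Brem)) (rankN-⊆ {F} {⊥} N⊥⊆)

  private variable
    F : Subset n
    Brem B₁ B₂ : Subset k
    ρ₁ ρ₂ : ℚ

  ∪-⊆-Brem : StepOK F Brem ρ₁ B₁ → StepOK (next F (N B₁)) (Brem ─ B₁) ρ₂ B₂ → B₁ ∪ B₂ ⊆ Brem
  ∪-⊆-Brem {Brem = Brem} {B₁ = B₁} step₁ step₂ =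
    ∪-lub (StepOK.Bl⊆Brem step₁) (p─q⊆p Brem B₁ ∘ StepOK.Bl⊆Brem step₂)

  ∪-attains : StepOK F Brem ρ₁ B₁ → StepOK (next F (N B₁)) (Brem ─ B₁) ρ₂ B₂
            → ρ₁ ≤ ρ₂ → rankN (next F (N B₁)) B₂ ≢ 0 → InvExpEq F (B₁ ∪ B₂) ρ₁
  ∪-attains {F = F} {Brem} {ρ₁} {B₁} {ρ₂} {B₂} step₁ step₂ ρ₁≤ρ₂ r₂≢0 =
    InvExpEq⁺ F (B₁ ∪ B₂) r≢0 (ℚ.≤-antisym ρ₁r≤m
      (InvExpLe⇒ F (B₁ ∪ B₂) (StepOK.isMax step₁ (B₁ ∪ B₂) (∪-⊆-Brem step₁ step₂))))
    where
    r₁ r₂ : ℕ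
    r₁ = rankN F B₁
    r₂ = rankN (next F (N B₁)) B₂
    r≢0 : rankN F (B₁ ∪ B₂) ≢ 0
    r≢0 r≡0 = r₂≢0 (ℕ.m+n≡0⇒m≡0 r₂ (trans (sym (rankN-next F B₁ B₂)) r≡0))
    disjoint : ∀ {x} → x ∈ B₂ → x ∉ B₁
    disjoint = x∈p─q⇒x∉q Brem B₁ ∘ StepOK.Bl⊆Brem step₂
    ρ₁r≤m : ρ₁ * toℚ (rankN F (B₁ ∪ B₂)) ≤ toℚ (m (B₁ ∪ B₂))
    ρ₁r≤m = begin
      ρ₁ * toℚ (rankN F (B₁ ∪ B₂))     ≡⟨ cong (λ r → ρ₁ * toℚ r) (rankN-next F B₁ B₂) ⟩
      ρ₁ * toℚ (r₂ ℕ.+ r₁)             ≡⟨ cong (ρ₁ *_) (toℚ-+ r₂ r₁) ⟩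
      ρ₁ * (toℚ r₂ ℚ.+ toℚ r₁)         ≡⟨ ℚ.*-distribˡ-+ ρ₁ (toℚ r₂) (toℚ r₁) ⟩
      ρ₁ * toℚ r₂ ℚ.+ ρ₁ * toℚ r₁      ≤⟨ ℚ.+-monoˡ-≤ (ρ₁ * toℚ r₁) (*-monoʳ-≤-toℚ r₂ ρ₁≤ρ₂) ⟩
      ρ₂ * toℚ r₂ ℚ.+ ρ₁ * toℚ r₁      ≡⟨ cong₂ ℚ._+_ (InvExpEq⇒ _ B₂ (StepOK.attains step₂))
                                                     (InvExpEq⇒ F B₁ (StepOK.attains step₁)) ⟩
      toℚ (m B₂) ℚ.+ toℚ (m B₁)        ≡⟨ toℚ-+ (m B₂) (m B₁) ⟨
      toℚ (m B₂ ℕ.+ m B₁)              ≡⟨ cong toℚ (trans (ℕ.+-comm (m B₂) (m B₁)) (sym (m-∪ B₁ B₂ disjoint))) ⟩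
      toℚ (m (B₁ ∪ B₂))                ∎
      where open ℚ.≤-Reasoning

  absorbed : StepOK F Brem ρ₁ B₁ → StepOK (next F (N B₁)) (Brem ─ B₁) ρ₂ B₂
           → ρ₁ ≤ ρ₂ → rankN (next F (N B₁)) B₂ ≢ 0 → B₂ ⊆ B₁
  absorbed {B₁ = B₁} {B₂ = B₂} step₁ step₂ ρ₁≤ρ₂ r₂≢0 =
    StepOK.largest step₁ (B₁ ∪ B₂) (∪-⊆-Brem step₁ step₂) (∪-attains step₁ step₂ ρ₁≤ρ₂ r₂≢0) ∘ q⊆p∪q B₁ B₂

  ρ-antitone : StepOK F Brem ρ₁ B₁ → StepOK (next F (N B₁)) (Brem ─ B₁) ρ₂ B₂ → ρ₂ ≤ ρ₁
  ρ-antitone {F = F} {ρ₁ = ρ₁} {B₁ = B₁} {ρ₂ = ρ₂} {B₂ = B₂} step₁ step₂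
    with ρ₂ ℚ.≤? ρ₁ | rankN (next F (N B₁)) B₂ ℕ.≟ 0
  ... | yes ρ₂≤ρ₁ | _       = ρ₂≤ρ₁
  ... | no _      | yes r₂≡0 =
    subst (_≤ ρ₁) (sym (InvExpEq-rank₀ _ B₂ (StepOK.attains step₂) r₂≡0)) (ρ-nonneg step₁)
  ... | no ρ₂≰ρ₁  | no r₂≢0  =
    ⊥-elim (r₂≢0 (rankN-⊆ {_} {B₂} (Y⊆next ∘ N-mono {B₂} {B₁} (absorbed step₁ step₂ (ℚ.<⇒≤ (ℚ.≰⇒> ρ₂≰ρ₁)) r₂≢0))))

  priced : ∀ {F Brem ls p} → Run F Brem ls p → OwnsComplement Brem F
         → ∀ e → e ∉ F → Any (λ l → p e ≡ Level.ρ l) ls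
  priced {ls = []}            stop                 owns e e∉F = ⊥-elim (stop (owner e) (owns e e∉F))
  priced {F} {ls = level ρ B ∷ _} (_ , priced-ρ , rest) owns e e∉F with e ∈? next F (N B)
  ... | yes e∈F′ = here (priced-ρ e (∈next⇒∈SpanC e∈F′ e∉F))
  ... | no  e∉F′ = there (priced rest (ownsComplement-next owns) e e∉F′)

  levels-nonneg : ∀ {F Brem ls p} → Run F Brem ls p → All (λ l → 0ℚ ≤ Level.ρ l) ls
  levels-nonneg {ls = []}          _              = []
  levels-nonneg {ls = level _ _ ∷ _} (step , _ , rest) = ρ-nonneg step ∷ levels-nonneg rest

  levels-≤-head : ∀ {F Brem ρ B ls p} → Run F Brem (level ρ B ∷ ls) p → All (λ l → Level.ρ l ≤ ρ) (level ρ B ∷ ls)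
  levels-≤-head {ls = []}            _                               = ℚ.≤-refl ∷ []
  levels-≤-head {ls = level _ _ ∷ _} (step₁ , _ , rest@(step₂ , _)) =
    ℚ.≤-refl ∷ All.map (λ ρ≤ρ₂ → ℚ.≤-trans ρ≤ρ₂ (ρ-antitone step₁ step₂)) (levels-≤-head rest)

  price-nonneg : ∀ {F Brem ls p} → Run F Brem ls p → OwnsComplement Brem F → ∀ e → e ∉ F → 0ℚ ≤ p e
  price-nonneg run owns e e∉F with All.lookupAny (levels-nonneg run) (priced run owns e e∉F)
  ... | 0≤ρ , pe≡ρ = subst (0ℚ ≤_) (sym pe≡ρ) 0≤ρ

  price-≤-head : ∀ {F Brem ρ B ls p} → Run F Brem (level ρ B ∷ ls) p → OwnsComplement Brem F
               → ∀ e → e ∉ F → p e ≤ ρ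
  price-≤-head {ρ = ρ} run owns e e∉F with All.lookupAny (levels-≤-head run) (priced run owns e e∉F)
  ... | ρ′≤ρ , pe≡ρ′ = subst (_≤ ρ) (sym pe≡ρ′) ρ′≤ρ

  module _ (t : ℚ) where

    -- A collects the buyers of the levels whose price is at least t.
    record UpperSpan (F : Subset n) (Brem : Subset k) (p : Fin n → ℚ) : Set where
      field
        A        : Subset k
        A⊆Brem   : A ⊆ Brem
        spans-≥t : ∀ e → e ∉ F → t ≤ p e → Spans (N A ∪ F) e
        budget-≥ : ∀ X → X ⊆ A → t * toℚ (rank (N A ∪ F) ℕ.∸ rank (N (A ─ X) ∪ F)) ≤ toℚ (m X)

    upperSpan-none : ∀ {F Brem p} → (∀ e → e ∉ F → p e < t) → UpperSpan F Brem p
    upperSpan-none {F} {Brem} cheap = record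
      { A        = ⊥
      ; A⊆Brem   = ⊆-min Brem
      ; spans-≥t = λ e e∉F t≤pe → ⊥-elim (ℚ.<-irrefl refl (ℚ.<-≤-trans (cheap e e∉F) t≤pe))
      ; budget-≥ = λ X _ → no-budget X
      }
      where
      no-budget : ∀ X → t * toℚ (rank (N ⊥ ∪ F) ℕ.∸ rank (N (⊥ ─ X) ∪ F)) ≤ toℚ (m X)
      no-budget X = begin
        t * toℚ (rank (N ⊥ ∪ F) ℕ.∸ rank (N (⊥ ─ X) ∪ F))
          ≡⟨ cong (λ r → t * toℚ r) (ℕ.m≤n⇒m∸n≡0 (rank-⊆ (∪-mono N⊥⊆ id))) ⟩
        t * 0ℚ                                             ≡⟨ ℚ.*-zeroʳ t ⟩
        0ℚ                                                 ≤⟨ toℚ-nonNeg (m X) ⟩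
        toℚ (m X)                                          ∎
        where open ℚ.≤-Reasoning

    level-budget : ∀ {F Brem ρ B} → StepOK F Brem ρ B → t ≤ ρ
                 → ∀ X → t * toℚ (rank (N B ∪ F) ℕ.∸ rank (N (B ─ X) ∪ F)) ≤ toℚ (m (B ∩ X))
    level-budget {F} {Brem} {ρ} {B} step t≤ρ X = begin
      t * toℚ (c ℕ.∸ d)         ≡⟨ cong (λ r → t * toℚ r) ([m∸o]∸[n∸o]≡m∸n c d (rank F) (rank-⊆ (q⊆p∪q _ F))) ⟨
      t * toℚ (rB ℕ.∸ rY)       ≤⟨ *-monoʳ-≤-toℚ (rB ℕ.∸ rY) t≤ρ ⟩
      ρ * toℚ (rB ℕ.∸ rY)       ≤⟨ *-∸-≤-split ρ (m (B ∩ X)) (m (B ─ X)) (rankN-mono F (p─q⊆p B X)) ρrB≡mB mY≤ρrY ⟩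
      toℚ (m (B ∩ X))           ∎
      where
      open ℚ.≤-Reasoning
      c d rB rY : ℕ
      c = rank (N B ∪ F)
      d = rank (N (B ─ X) ∪ F)
      rB = rankN F B
      rY = rankN F (B ─ X)
      ρrB≡mB : ρ * toℚ rB ≡ toℚ (m (B ∩ X) ℕ.+ m (B ─ X))
      ρrB≡mB = trans (InvExpEq⇒ F B (StepOK.attains step)) (cong toℚ (m-split B X))
      mY≤ρrY : toℚ (m (B ─ X)) ≤ ρ * toℚ rY
      mY≤ρrY = InvExpLe⇒ F (B ─ X) (StepOK.isMax step (B ─ X) (StepOK.Bl⊆Brem step ∘ p─q⊆p B X))

    upperSpan-step : ∀ {F Brem ρ B p} → 0ℚ ≤ t → StepOK F Brem ρ B → t ≤ ρ
                   → UpperSpan (next F (N B)) (Brem ─ B) p → UpperSpan F Brem p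
    upperSpan-step {F} {Brem} {ρ} {B} {p} 0≤t step t≤ρ R = record
      { A        = B ∪ R.A
      ; A⊆Brem   = ∪-lub (StepOK.Bl⊆Brem step) (p─q⊆p Brem B ∘ R.A⊆Brem)
      ; spans-≥t = spans-≥t
      ; budget-≥ = budget-≥
      }
      where
      module R = UpperSpan R
      F′ : Subset n
      F′ = next F (N B)
      spans-≥t : ∀ e → e ∉ F → t ≤ p e → Spans (N (B ∪ R.A) ∪ F) e
      spans-≥t e e∉F t≤pe with e ∈? F′
      ... | yes e∈F′ = Spans-mono (∪-mono (N-mono {B} {B ∪ R.A} (p⊆p∪q R.A)) id) (∈next⇒Spans e∈F′)
      ... | no  e∉F′ = Spans-restrict (N-∪-⊆-next F B R.A) (rank-N-next F B R.A) (R.spans-≥t e e∉F′ t≤pe)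
      budget-≥ : ∀ X → X ⊆ B ∪ R.A → t * toℚ (rank (N (B ∪ R.A) ∪ F) ℕ.∸ rank (N ((B ∪ R.A) ─ X) ∪ F)) ≤ toℚ (m X)
      budget-≥ X X⊆A = begin
        t * toℚ (rank (N (B ∪ R.A) ∪ F) ℕ.∸ rank (N ((B ∪ R.A) ─ X) ∪ F))
          ≤⟨ ℚ.*-monoˡ-≤-nonNeg t {{ℚ.nonNegative 0≤t}} (toℚ-mono-≤ (rank-drop-split F B R.A X disjoint)) ⟩
        t * toℚ (δ′ ℕ.+ δ)             ≡⟨ cong (t *_) (toℚ-+ δ′ δ) ⟩
        t * (toℚ δ′ ℚ.+ toℚ δ)         ≡⟨ ℚ.*-distribˡ-+ t (toℚ δ′) (toℚ δ) ⟩
        t * toℚ δ′ ℚ.+ t * toℚ δ       ≤⟨ ℚ.+-mono-≤ (R.budget-≥ (X ─ B) X─B⊆A′) (level-budget step t≤ρ X) ⟩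
        toℚ (m (X ─ B)) ℚ.+ toℚ (m (B ∩ X))   ≡⟨ toℚ-+ (m (X ─ B)) (m (B ∩ X)) ⟨
        toℚ (m (X ─ B) ℕ.+ m (B ∩ X))         ≡⟨ cong toℚ m-X ⟩
        toℚ (m X)                             ∎
        where
        open ℚ.≤-Reasoning
        δ′ δ : ℕ
        δ′ = rank (N R.A ∪ F′) ℕ.∸ rank (N (R.A ─ (X ─ B)) ∪ F′)
        δ = rank (N B ∪ F) ℕ.∸ rank (N (B ─ X) ∪ F)
        disjoint : ∀ {o} → o ∈ R.A → o ∉ B
        disjoint = x∈p─q⇒x∉q Brem B ∘ R.A⊆Brem
        X─B⊆A′ : X ─ B ⊆ R.A
        X─B⊆A′ x∈ = [ ⊥-elim ∘ x∈p─q⇒x∉q X B x∈ , id ] (x∈p∪q⁻ B R.A (X⊆A (p─q⊆p X B x∈)))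
        m-X : m (X ─ B) ℕ.+ m (B ∩ X) ≡ m X
        m-X = trans (ℕ.+-comm (m (X ─ B)) (m (B ∩ X)))
                    (trans (cong (λ Y → m Y ℕ.+ m (X ─ B)) (∩-comm B X)) (sym (m-split X B)))

    upperSpan : ∀ {F Brem ls p} → 0ℚ ≤ t → Run F Brem ls p → OwnsComplement Brem F → UpperSpan F Brem p
    upperSpan {ls = []} _ stop owns = upperSpan-none (λ e e∉F → ⊥-elim (stop (owner e) (owns e e∉F)))
    upperSpan {ls = level ρ B ∷ _} 0≤t run@(step , _ , rest) owns with t ℚ.≤? ρ
    ... | yes t≤ρ = upperSpan-step 0≤t step t≤ρ (upperSpan 0≤t rest (ownsComplement-next owns))
    ... | no  t≰ρ = upperSpan-none (λ e e∉F → ℚ.≤-<-trans (price-≤-head run owns e e∉F) (ℚ.≰⇒> t≰ρ))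

    HeadBelow : List Level → Set
    HeadBelow []              = Unit
    HeadBelow (level σ _ ∷ _) = σ < t

    -- G is E_ℓ at the first level ℓ whose price is below t, and C collects the buyers priced before it.
    record UpperFlat (G₀ : Subset n) (Brem : Subset k) (ls : List Level) (p : Fin n → ℚ) : Set where
      field
        G          : Subset n
        C          : Subset k
        G₀⊆G       : G₀ ⊆ G
        ≥t-on-G    : ∀ e → e ∈ G → e ∉ G₀ → t ≤ p e
        flat       : Flat G ⊎ (G ≡ G₀ × HeadBelow ls)
        NC⊆G       : N C ⊆ G
        overpriced : ∀ X → X ⊆ Brem ─ C → rankN G X ≢ 0 → toℚ (m X) < t * toℚ (rankN G X)

    upperFlat-none : ∀ {G₀ Brem ls p} → HeadBelow ls
                   → (∀ X → X ⊆ Brem → rankN G₀ X ≢ 0 → toℚ (m X) < t * toℚ (rankN G₀ X))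
                   → UpperFlat G₀ Brem ls p
    upperFlat-none {G₀} {Brem} below overpriced = record
      { G          = G₀
      ; C          = ⊥
      ; G₀⊆G       = id
      ; ≥t-on-G    = λ _ e∈G₀ e∉G₀ → ⊥-elim (e∉G₀ e∈G₀)
      ; flat       = inj₂ (refl , below)
      ; NC⊆G       = N⊥⊆
      ; overpriced = λ X X⊆ → overpriced X (p─q⊆p Brem ⊥ ∘ X⊆)
      }

    upperFlat : ∀ {G₀ Brem ls p} → Run G₀ Brem ls p → UpperFlat G₀ Brem ls p
    upperFlat {G₀} {ls = []} stop =
      upperFlat-none tt (λ X X⊆Brem r≢0 → ⊥-elim (r≢0 (rankN-⊆ {G₀} {X} (⊥-elim ∘ stop _ ∘ X⊆Brem ∘ x∈N⁻))))
    upperFlat {G₀} {Brem} {level σ B ∷ ls} {p} (step , priced-σ , rest) with t ℚ.≤? σ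
    ... | no t≰σ = upperFlat-none (ℚ.≰⇒> t≰σ) λ X X⊆Brem r≢0 →
      ℚ.≤-<-trans (InvExpLe⇒ G₀ X (StepOK.isMax step X X⊆Brem))
                  (ℚ.*-monoˡ-<-pos (toℚ (rankN G₀ X)) {{toℚ-positive r≢0}} (ℚ.≰⇒> t≰σ))
    ... | yes t≤σ = record
      { G          = R.G
      ; C          = B ∪ R.C
      ; G₀⊆G       = R.G₀⊆G ∘ F⊆next
      ; ≥t-on-G    = ≥t-on-G
      ; flat       = [ inj₁ , (λ (G≡F′ , _) → inj₁ (subst Flat (sym G≡F′) (next-flat G₀ (N B)))) ]′ R.flat
      ; NC⊆G       = ∪-lub (R.G₀⊆G ∘ Y⊆next) R.NC⊆G ∘ subst (_ ∈_) (N-∪ B R.C)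
      ; overpriced = λ X X⊆ → R.overpriced X (subst (_ ∈_) (sym (p─q─r≡p─q∪r Brem B R.C)) ∘ X⊆)
      }
      where
      R : UpperFlat (next G₀ (N B)) (Brem ─ B) ls p
      R = upperFlat rest
      module R = UpperFlat R
      ≥t-on-G : ∀ e → e ∈ R.G → e ∉ G₀ → t ≤ p e
      ≥t-on-G e e∈G e∉G₀ with e ∈? next G₀ (N B)
      ... | yes e∈F′ = subst (t ≤_) (sym (priced-σ e (∈next⇒∈SpanC e∈F′ e∉G₀))) t≤σ
      ... | no  e∉F′ = R.≥t-on-G e e∈G e∉F′

arrive-⊇ : ∀ {k} (arr : Fin k → Bool) iinc j → T (arr j) → T (arrive arr iinc j)
arrive-⊇ arr iinc j arrived with does (j ≟ iinc)
... | true  = tt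
... | false = arrived

module Arrival {k : ℕ} {rank : Subset n → ℕ} (isMatroid : IsMatroidRank rank) (owner : Fin n → Fin k)
               {arr arr′ : Fin k → Bool} (arr⊆arr′ : ∀ j → T (arr j) → T (arr′ j)) where

  open Rank isMatroid
  open Skeleton isMatroid owner
  module Old = Runs isMatroid owner arr
  module New = Runs isMatroid owner arr′
  open Old using (N; level)

  m-mono-budget : ∀ X → Old.m X ℕ.≤ New.m X
  m-mono-budget X = p⊆q⇒∣p∣≤∣q∣ λ x∈ →
    let x∈X , x∈arr = x∈p∩q⁻ X _ x∈ in x∈p∩q⁺ (x∈X , x∈tabulate⁺ arr′ (arr⊆arr′ _ (x∈tabulate⁻ arr x∈arr)))

  head-mono : ∀ {F Brem ρ B σ C} → Old.StepOK F Brem ρ B → New.StepOK F Brem σ C → ρ ≤ σ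
  head-mono {F} {Brem} {ρ} {B} {σ} old new with rankN F B ℕ.≟ 0
  ... | yes r≡0 = subst (_≤ σ) (sym (Old.InvExpEq-rank₀ F B (Old.StepOK.attains old) r≡0)) (New.ρ-nonneg new)
  ... | no  r≢0 = ℚ.*-cancelʳ-≤-pos (toℚ (rankN F B)) {{toℚ-positive r≢0}} (begin
    ρ * toℚ (rankN F B)       ≡⟨ Old.InvExpEq⇒ F B (Old.StepOK.attains old) ⟩
    toℚ (Old.m B)             ≤⟨ toℚ-mono-≤ (m-mono-budget B) ⟩
    toℚ (New.m B)             ≤⟨ New.InvExpLe⇒ F B (New.StepOK.isMax new B (Old.StepOK.Bl⊆Brem old)) ⟩
    σ * toℚ (rankN F B)       ∎)
    where open ℚ.≤-Reasoning

  rank[NA∪G]≡rank[G] : ∀ {t F Brem ls pold pnew} → 0ℚ ≤ t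
    → (old : Old.UpperSpan t F Brem pold) (new : New.UpperFlat t F Brem ls pnew)
    → rank (N (Old.UpperSpan.A old) ∪ New.UpperFlat.G new) ≡ rank (New.UpperFlat.G new)
  rank[NA∪G]≡rank[G] {t} {F} {Brem} 0≤t old new =
    rank-squeeze (q⊆p∪q (N A) G) NA∪G⊆NX∪G (ℕ.≤-antisym (ℕ.m∸n≡0⇒m≤n rankN≡0) (rank-⊆ (q⊆p∪q (N X) G)))
    where
    open Old.UpperSpan old
    open New.UpperFlat new
    X : Subset k
    X = A ─ C
    A─X⊆C : A ─ X ⊆ C
    A─X⊆C o∈ = [ ⊥-elim ∘ x∈p─q⇒x∉q A X o∈ , id ]′ (x∈p∪q⁻ X C (p⊆[p─q]∪q A C (p─q⊆p A X o∈)))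
    NA∪G⊆NX∪G : N A ∪ G ⊆ N X ∪ G
    NA∪G⊆NX∪G = ∪-lub (∪-mono id NC⊆G ∘ subst (_ ∈_) (N-∪ X C) ∘ N-mono {A} {X ∪ C} (p⊆[p─q]∪q A C))
                      (q⊆p∪q (N X) G)
    U W : Subset n
    U = N A ∪ F
    W = N (A ─ X) ∪ F
    rankN-G-X≤ : rankN G X ℕ.≤ rank U ℕ.∸ rank W
    rankN-G-X≤ = ℕ.≤-trans (ℕ.∸-monoˡ-≤ (rank G) (rank-⊆ (∪-mono (p⊆p∪q F ∘ N-mono {X} {A} (p─q⊆p A C)) id)))
                           (rank-∸-submod U G (λ w∈ → x∈p∩q⁺ (∪-mono (N-mono {A ─ X} {A} (p─q⊆p A X)) id w∈
                                                            , ∪-lub (NC⊆G ∘ N-mono {A ─ X} {C} A─X⊆C) G₀⊆G w∈)))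
    budget-gap : t * toℚ (rankN G X) ≤ toℚ (New.m X)
    budget-gap = begin
      t * toℚ (rankN G X)              ≤⟨ ℚ.*-monoˡ-≤-nonNeg t {{ℚ.nonNegative 0≤t}} (toℚ-mono-≤ rankN-G-X≤) ⟩
      t * toℚ (rank U ℕ.∸ rank W)      ≤⟨ budget-≥ X (p─q⊆p A C) ⟩
      toℚ (Old.m X)                    ≤⟨ toℚ-mono-≤ (m-mono-budget X) ⟩
      toℚ (New.m X)                    ∎
      where open ℚ.≤-Reasoning
    -- budget-gap (old run, growing budgets) contradicts overpriced (new run) unless G spans N X.
    rankN≡0 : rankN G X ≡ 0
    rankN≡0 with rankN G X ℕ.≟ 0
    ... | yes r≡0 = r≡0
    ... | no  r≢0 = ⊥-elim (ℚ.<-irrefl refl (ℚ.<-≤-trans (overpriced X X⊆Brem─C r≢0) budget-gap))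
      where
      X⊆Brem─C : X ⊆ Brem ─ C
      X⊆Brem─C x∈ = x∈p∧x∉q⇒x∈p─q (A⊆Brem (p─q⊆p A C x∈)) (x∈p─q⇒x∉q A C x∈)

  headBelow-impossible : ∀ {F Brem lsO lsN pold pnew e} → OwnsComplement Brem F → e ∉ F
    → Old.Run F Brem lsO pold → New.Run F Brem lsN pnew → ¬ New.HeadBelow (pold e) lsN
  headBelow-impossible {lsN = []} {e = e} owns e∉F _ stop _ = stop (owner e) (owns e e∉F)
  headBelow-impossible {lsO = []} {lsN = _ ∷ _} {e = e} owns e∉F stop _ _ = stop (owner e) (owns e e∉F)
  headBelow-impossible {lsO = level _ _ ∷ _} {lsN = level _ _ ∷ _} {e = e} owns e∉F runO runN σ<pe =
    ℚ.<-irrefl refl (ℚ.<-≤-trans σ<pe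
      (ℚ.≤-trans (Old.price-≤-head runO owns e e∉F) (head-mono (proj₁ runO) (proj₁ runN))))

mainTheorem10 : {n k : ℕ} (rank : Subset n → ℕ) → IsMatroidRank rank
    → (owner : Fin n → Fin k) (arr : Fin k → Bool) (iinc : Fin k) → arr iinc ≡ false
    → (pold pnew : Fin n → ℚ)
    → Market.CanonicalPrices rank owner arr pold
    → Market.CanonicalPrices rank owner (arrive arr iinc) pnew
    → (i : Fin k) (qold qnew : ℚ)
    → IsMinPrice owner pold i qold → IsMinPrice owner pnew i qnew
    → qold ≤ qnew
mainTheorem10 rank isMatroid owner arr iinc _ pold pnew (lsO , runO) (lsN , runN) i qold qnew
  ((e₀ , _ , pold-e₀≡qold) , qold-min) ((e₁ , owner-e₁≡i , pnew-e₁≡qnew) , _) =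
  subst (qold ≤_) pnew-e₁≡qnew qold≤pnew-e₁
  where
  open Rank isMatroid
  open Skeleton isMatroid owner using (OwnsComplement)
  open Arrival isMatroid owner (arrive-⊇ arr iinc)
  owns : OwnsComplement ⊤ ⊥
  owns _ _ = ∈⊤
  0≤qold : 0ℚ ≤ qold
  0≤qold = subst (0ℚ ≤_) pold-e₀≡qold (Old.price-nonneg runO owns e₀ ∉⊥)
  old : Old.UpperSpan qold ⊥ ⊤ pold
  old = Old.upperSpan qold 0≤qold runO owns
  new : New.UpperFlat qold ⊥ ⊤ lsN pnew
  new = New.upperFlat qold runN
  open New.UpperFlat new using (G; flat; ≥t-on-G)
  G-spans-e₁ : Spans G e₁
  G-spans-e₁ = Spans-restrict (q⊆p∪q _ G) (rank[NA∪G]≡rank[G] 0≤qold old new)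
    (Spans-mono (∪-mono id (⊆-min G)) (Old.UpperSpan.spans-≥t old e₁ ∉⊥ (qold-min e₁ owner-e₁≡i)))
  qold≤pnew-e₁ : qold ≤ pnew e₁
  qold≤pnew-e₁ with flat | e₁ ∈? G
  ... | _                | yes e₁∈G = ≥t-on-G e₁ e₁∈G ∉⊥
  ... | inj₁ G-flat      | no  e₁∉G = ⊥-elim (G-flat e₁ e₁∉G G-spans-e₁)
  ... | inj₂ (_ , below) | no  _    = ⊥-elim (headBelow-impossible owns ∉⊥ runO runN
                                        (subst (λ q → New.HeadBelow q lsN) (sym pold-e₀≡qold) below))
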